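{- Let $G=(V,E)$ be a finite graph with nonnegative edge weights $w:E\to\mathbb{R}_+$, and let $\Gamma_G(V,c)$ be the associated edge cover game. A vector $a\in\mathbb{R}_+^{V}$ satisfies the core property of $\Gamma_G(V,c)$ if and only if for every vertex $v\in V$ and every nonempty subset $T\subseteq N(v)$ we have $a(T\cup\{v\})\le\sum_{e\in\delta(v,T)}w_e$.
   Context: The edge cover game $\Gamma_G(V,c)$ has player set $V$, and for $S\subseteq V$ the cost $c(S)$ is the minimum total weight of a set of edges $K\subseteq E[S]\cup\delta(S)$ such that every vertex of $S$ is incident to some edge of $K$ (with $c(S)=+\infty$ if no such set exists); here $E[S]$ is the set of edges with both endpoints in $S$ and $\delta(S)$ is the set of edges with exactly one endpoint in $S$. For $a\in\mathbb{R}^V$ and $S\subseteq V$, $a(S)=\sum_{i\in S}a_i$. A vector $a\in\mathbb{R}_+^V$ satisfies the core property if $a(S)\le c(S)$ for all $S\subseteq V$. $N(v)$ is the set of neighbours of $v$, and for $T\subseteq N(v)$, $\delta(v,T)$ is the set of edges between $v$ and vertices of $T$.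
   Formalization: The edge weights $w$ and the vector $a$ take values in the nonnegative rationals rather than in $\mathbb{R}_+$. -}

module Defs where

open import Data.Nat using (ℕ; zero; suc)
open import Data.Fin using (Fin; zero; suc; _<_)
open import Data.Bool using (Bool; true; false; if_then_else_)
open import Data.Vec using (lookup; tabulate)
open import Data.Fin.Subset using (Subset; _∈_; _⊆_; _∪_; ⁅_⁆; Nonempty)
open import Data.Rational using (ℚ; 0ℚ; _+_; _≤_)
open import Data.Product using (_×_; ∃)
open import Data.Sum using (_⊎_)
open import Relation.Binary.PropositionalEquality using (_≡_)

ΣFin : (n : ℕ) → (Fin n → ℚ) → ℚ
ΣFin zero    f = 0ℚ
ΣFin (suc n) f = f zero + ΣFin n (λ i → f (suc i))

record WGraph (n : ℕ) : Set where
  field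
    adj        : Fin n → Fin n → Bool
    adj-irrefl : ∀ i → adj i i ≡ false
    adj-sym    : ∀ i j → adj i j ≡ adj j i
    w          : Fin n → Fin n → ℚ
    w-sym      : ∀ i j → w i j ≡ w j i
    w-nonneg   : ∀ i j → 0ℚ ≤ w i j

module _ {n : ℕ} (G : WGraph n) where
  open WGraph G

  sumOver : (Fin n → ℚ) → Subset n → ℚ
  sumOver a S = ΣFin n (λ i → if lookup S i then a i else 0ℚ)

  -- A set of edges: K i j ≡ true (only for i < j) means edge {i,j} is in K.
  EdgeSet : Set
  EdgeSet = Fin n → Fin n → Bool

  IsEdgeSet : EdgeSet → Set
  IsEdgeSet K = ∀ i j → K i j ≡ true → (i < j) × (adj i j ≡ true)

  edgeWeight : EdgeSet → ℚ
  edgeWeight K = ΣFin n (λ i → ΣFin n (λ j → if K i j then w i j else 0ℚ))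

  FeasibleCover : Subset n → EdgeSet → Set
  FeasibleCover S K =
    IsEdgeSet K
    × (∀ i j → K i j ≡ true → (i ∈ S) ⊎ (j ∈ S))
    × (∀ v → v ∈ S → ∃ λ u → (K v u ≡ true) ⊎ (K u v ≡ true))

  -- a(S) ≤ c(S) for all S, where c(S) is the minimum weight of a feasible
  -- cover (+∞ if none): written out as a(S) ≤ weight(K) for every feasible K.
  CoreProperty : (Fin n → ℚ) → Set
  CoreProperty a = ∀ (S : Subset n) (K : EdgeSet) → FeasibleCover S K →
                   sumOver a S ≤ edgeWeight K

  nbhd : Fin n → Subset n
  nbhd v = tabulate (adj v)

  starWeight : Fin n → Subset n → ℚ
  starWeight v T = ΣFin n (λ u → if lookup T u then w v u else 0ℚ)

  StarCondition : (Fin n → ℚ) → Set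
  StarCondition a = ∀ (v : Fin n) (T : Subset n) → T ⊆ nbhd v → Nonempty T →
                    sumOver a (T ∪ ⁅ v ⁆) ≤ starWeight v T

-- A star at v with leaf set T ⊆ N(v) is itself a feasible cover of T ∪ {v} of weight
-- w(δ(v,T)), so the core property implies the star condition. Conversely, let every
-- u ∈ S pick a partner p(u) with {u,p(u)} ∈ K. The map p splits S into stars: u is a
-- leaf of the star centred at p(u), except that of a mutual pair u = p(v), v = p(u)
-- only one endpoint is made a leaf. Every u ∈ S lies in a star with a nonempty leaf
-- set, and distinct (centre, leaf) pairs use distinct edges of K, so summing the star
-- condition over all centres bounds a(S) by w(K). Edge sets are relations on ordered pairs;
-- their weights are compared pair by pair after symmetrising the double sum.
module Submission where

open import Defs
open import Data.Nat using (ℕ; zero; suc)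
open import Data.Fin using (Fin; zero; suc; _<_; _≟_; _<?_)
open import Data.Fin.Properties using (<-cmp; <-asym; suc-injective)
open import Data.Bool using (Bool; true; false; _∧_; if_then_else_)
open import Data.Vec using (_∷_; lookup; tabulate)
open import Data.Vec.Properties using (lookup∘tabulate; lookup-replicate; []=⇒lookup; lookup⇒[]=)
open import Data.Vec.Functional using (Vector)
open import Data.Fin.Subset using (Subset; _∈_; _⊆_; _∪_; ⁅_⁆; Nonempty) renaming (⊥ to ∅)
open import Data.Fin.Subset.Properties using (_∈?_; nonempty?; x∈p∪q⁺; x∈p∪q⁻; x∈⁅x⁆; x∈⁅y⁆⇒x≡y)
open import Data.Rational using (ℚ; 0ℚ; _+_; _≤_; _≤?_)
open import Data.Rational.Properties
  using (≤-refl; ≤-reflexive; +-mono-≤; +-monoˡ-≤; +-monoʳ-≤; +-mono-<; <-≤-trans; <-irrefl;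
         ≰⇒>; +-comm; +-identityʳ; +-identityˡ; +-0-commutativeMonoid; module ≤-Reasoning)
open import Algebra.Properties.CommutativeMonoid.Sum +-0-commutativeMonoid
  using (sum; sum-cong-≗; sum-replicate-zero; ∑-distrib-+; ∑-comm)
open import Data.Empty using (⊥)
open import Data.Product using (_×_; _,_; proj₁; proj₂; ∃)
open import Data.Sum using (_⊎_; inj₁; inj₂; [_,_])
import Data.Sum as Sum
open import Function using (_∘_)
open import Level using (0ℓ)
open import Function.Bundles using (_⇔_; mk⇔)
open import Relation.Binary using (Rel; Decidable; tri<; tri≈; tri>)
open import Relation.Nullary using (Dec; yes; no; ¬_; does; ¬?; _×-dec_; _⊎-dec_; contradiction)
open import Relation.Nullary.Decidable using (dec-true; dec-false)
open import Relation.Binary.PropositionalEquality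
  using (_≡_; _≢_; refl; sym; trans; cong; cong₂; subst; module ≡-Reasoning)

does≡true⇒ : ∀ {a} {A : Set a} (a? : Dec A) → does a? ≡ true → A
does≡true⇒ (yes a) _ = a
does≡true⇒ (no _)  ()

does-∈? : ∀ {n} (x : Fin n) (p : Subset n) → does (x ∈? p) ≡ lookup p x
does-∈? zero    (true  ∷ p) = refl
does-∈? zero    (false ∷ p) = refl
does-∈? (suc x) (_     ∷ p) = does-∈? x p

∈-tabulate⁺ : ∀ {n} {f : Fin n → Bool} {x} → f x ≡ true → x ∈ tabulate f
∈-tabulate⁺ {f = f} {x} fx = lookup⇒[]= x (tabulate f) (trans (lookup∘tabulate f x) fx)

∈-tabulate⁻ : ∀ {n} {f : Fin n → Bool} {x} → x ∈ tabulate f → f x ≡ true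
∈-tabulate⁻ {f = f} {x} x∈ = trans (sym (lookup∘tabulate f x)) ([]=⇒lookup x∈)

if-nonneg : ∀ b {x} → 0ℚ ≤ x → 0ℚ ≤ (if b then x else 0ℚ)
if-nonneg true  0≤x = 0≤x
if-nonneg false _   = ≤-refl

x+x≤y+y⇒x≤y : ∀ {x y} → x + x ≤ y + y → x ≤ y
x+x≤y+y⇒x≤y {x} {y} x+x≤y+y with x ≤? y
... | yes x≤y = x≤y
... | no  x≰y = contradiction (<-≤-trans (+-mono-< y<x y<x) x+x≤y+y) (<-irrefl refl)
  where y<x = ≰⇒> x≰y

ΣFin-cong : ∀ n {f g : Fin n → ℚ} → (∀ i → f i ≡ g i) → ΣFin n f ≡ ΣFin n g
ΣFin-cong zero    f≗g = refl
ΣFin-cong (suc n) f≗g = cong₂ _+_ (f≗g zero) (ΣFin-cong n (f≗g ∘ suc))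

ΣFin≡sum : ∀ n (f : Vector ℚ n) → ΣFin n f ≡ sum f
ΣFin≡sum zero    f = refl
ΣFin≡sum (suc n) f = cong (f zero +_) (ΣFin≡sum n (f ∘ suc))

ΣFin-zero : ∀ n → ΣFin n (λ _ → 0ℚ) ≡ 0ℚ
ΣFin-zero n = trans (ΣFin≡sum n _) (sum-replicate-zero n)

ΣFin-distrib-+ : ∀ n (f g : Fin n → ℚ) → ΣFin n (λ i → f i + g i) ≡ ΣFin n f + ΣFin n g
ΣFin-distrib-+ n f g = begin
  ΣFin n (λ i → f i + g i)  ≡⟨ ΣFin≡sum n _ ⟩
  sum (λ i → f i + g i)     ≡⟨ ∑-distrib-+ f g ⟩
  sum f + sum g             ≡⟨ sym (cong₂ _+_ (ΣFin≡sum n f) (ΣFin≡sum n g)) ⟩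
  ΣFin n f + ΣFin n g       ∎
  where open ≡-Reasoning

ΣFin-comm : ∀ m n (f : Fin m → Fin n → ℚ) →
            ΣFin m (λ i → ΣFin n (f i)) ≡ ΣFin n (λ j → ΣFin m (λ i → f i j))
ΣFin-comm m n f = begin
  ΣFin m (λ i → ΣFin n (f i))              ≡⟨ ΣFin≡sum m _ ⟩
  sum (λ i → ΣFin n (f i))                 ≡⟨ sum-cong-≗ (λ i → ΣFin≡sum n (f i)) ⟩
  sum (λ i → sum (f i))                    ≡⟨ ∑-comm f ⟩
  sum (λ j → sum (λ i → f i j))            ≡⟨ sum-cong-≗ (λ j → sym (ΣFin≡sum m (λ i → f i j))) ⟩
  sum (λ j → ΣFin m (λ i → f i j))         ≡⟨ sym (ΣFin≡sum n _) ⟩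
  ΣFin n (λ j → ΣFin m (λ i → f i j))      ∎
  where open ≡-Reasoning

ΣFin-mono-≤ : ∀ n {f g : Fin n → ℚ} → (∀ i → f i ≤ g i) → ΣFin n f ≤ ΣFin n g
ΣFin-mono-≤ zero    f≤g = ≤-refl
ΣFin-mono-≤ (suc n) f≤g = +-mono-≤ (f≤g zero) (ΣFin-mono-≤ n (f≤g ∘ suc))

ΣFin-nonneg : ∀ n {f : Fin n → ℚ} → (∀ i → 0ℚ ≤ f i) → 0ℚ ≤ ΣFin n f
ΣFin-nonneg n {f} f≥0 = subst (_≤ ΣFin n f) (ΣFin-zero n) (ΣFin-mono-≤ n f≥0)

term≤ΣFin : ∀ n {f : Fin n → ℚ} → (∀ i → 0ℚ ≤ f i) → ∀ k → f k ≤ ΣFin n f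
term≤ΣFin (suc n) {f} f≥0 zero =
  subst (_≤ ΣFin (suc n) f) (+-identityʳ (f zero)) (+-monoʳ-≤ (f zero) (ΣFin-nonneg n (f≥0 ∘ suc)))
term≤ΣFin (suc n) {f} f≥0 (suc k) =
  subst (_≤ ΣFin (suc n) f) (+-identityˡ (f (suc k))) (+-mono-≤ (f≥0 zero) (term≤ΣFin n (f≥0 ∘ suc) k))

ΣFin-supported : ∀ n {f : Fin n → ℚ} k → (∀ i → i ≢ k → f i ≡ 0ℚ) → ΣFin n f ≡ f k
ΣFin-supported (suc n) {f} zero f≡0 = begin
  f zero + ΣFin n (f ∘ suc)    ≡⟨ cong (f zero +_) (ΣFin-cong n (λ i → f≡0 (suc i) λ ())) ⟩
  f zero + ΣFin n (λ _ → 0ℚ)   ≡⟨ cong (f zero +_) (ΣFin-zero n) ⟩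
  f zero + 0ℚ                  ≡⟨ +-identityʳ (f zero) ⟩
  f zero                       ∎
  where open ≡-Reasoning
ΣFin-supported (suc n) {f} (suc k) f≡0 = begin
  f zero + ΣFin n (f ∘ suc)
    ≡⟨ cong₂ _+_ (f≡0 zero λ ()) (ΣFin-supported n k λ i i≢k → f≡0 (suc i) (i≢k ∘ suc-injective)) ⟩
  0ℚ + f (suc k)               ≡⟨ +-identityˡ (f (suc k)) ⟩
  f (suc k)                    ∎
  where open ≡-Reasoning

ΣFin² : ∀ n → (Fin n → Fin n → ℚ) → ℚ
ΣFin² n f = ΣFin n (λ i → ΣFin n (f i))

ΣFin²-symmetrise : ∀ n (f : Fin n → Fin n → ℚ) →
                   ΣFin² n f + ΣFin² n f ≡ ΣFin² n (λ i j → f i j + f j i)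
ΣFin²-symmetrise n f = begin
  ΣFin² n f + ΣFin² n f                                ≡⟨ cong (ΣFin² n f +_) (ΣFin-comm n n f) ⟩
  ΣFin² n f + ΣFin² n (λ i j → f j i)                  ≡⟨ sym (ΣFin-distrib-+ n _ _) ⟩
  ΣFin n (λ i → ΣFin n (f i) + ΣFin n (λ j → f j i))   ≡⟨ ΣFin-cong n (λ i → sym (ΣFin-distrib-+ n _ _)) ⟩
  ΣFin² n (λ i j → f i j + f j i)                      ∎
  where open ≡-Reasoning

ΣFin²-mono-≤-symmetrised : ∀ n {f g : Fin n → Fin n → ℚ} →
                           (∀ i j → f i j + f j i ≤ g i j + g j i) → ΣFin² n f ≤ ΣFin² n g
ΣFin²-mono-≤-symmetrised n {f} {g} f≤g = x+x≤y+y⇒x≤y (begin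
  ΣFin² n f + ΣFin² n f              ≡⟨ ΣFin²-symmetrise n f ⟩
  ΣFin² n (λ i j → f i j + f j i)    ≤⟨ ΣFin-mono-≤ n (λ i → ΣFin-mono-≤ n (f≤g i)) ⟩
  ΣFin² n (λ i j → g i j + g j i)    ≡⟨ sym (ΣFin²-symmetrise n g) ⟩
  ΣFin² n g + ΣFin² n g              ∎)
  where open ≤-Reasoning

if-pair-≤ : ∀ {x} → 0ℚ ≤ x → ∀ a a' b b' →
            (a ≡ true → a' ≡ true → ⊥) →
            (a ≡ true → b ≡ true ⊎ b' ≡ true) → (a' ≡ true → b' ≡ true ⊎ b ≡ true) →
            (if a then x else 0ℚ) + (if a' then x else 0ℚ) ≤ (if b then x else 0ℚ) + (if b' then x else 0ℚ)
if-pair-≤     _   true  true  _     _     asym _ _ = contradiction refl (asym refl)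
if-pair-≤ {x} 0≤x true  false true  b'    _ _ _ = +-monoʳ-≤ x (if-nonneg b' 0≤x)
if-pair-≤ {x} _   true  false false true  _ _ _ = ≤-reflexive (+-comm x 0ℚ)
if-pair-≤     _   true  false false false _ b∨b' _ = [ (λ ()) , (λ ()) ] (b∨b' refl)
if-pair-≤ {x} 0≤x false true  b     true  _ _ _ = +-monoˡ-≤ x (if-nonneg b 0≤x)
if-pair-≤ {x} _   false true  true  false _ _ _ = ≤-reflexive (+-comm 0ℚ x)
if-pair-≤     _   false true  false false _ _ b'∨b = [ (λ ()) , (λ ()) ] (b'∨b refl)
if-pair-≤     0≤x false false b     b'    _ _ _ = +-mono-≤ (if-nonneg b 0≤x) (if-nonneg b' 0≤x)

choose-on : ∀ {n} {P : Fin n → Fin n → Set} (S : Subset n) →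
            (∀ v → v ∈ S → ∃ (P v)) → ∃ λ (f : Fin n → Fin n) → ∀ {v} → v ∈ S → P v (f v)
choose-on {P = P} S h = (λ v → proj₁ (pick v)) , λ {v} → proj₂ (pick v)
  where
  pick : ∀ v → ∃ λ u → v ∈ S → P v u
  pick v with v ∈? S
  ... | yes v∈S = proj₁ (h v v∈S) , λ _ → proj₂ (h v v∈S)
  ... | no  v∉S = v , λ v∈S → contradiction v∈S v∉S

module _ {n} (G : WGraph n) where
  open WGraph G

  sumOver-≤-cover : ∀ {m} {a : Fin n → ℚ} → (∀ i → 0ℚ ≤ a i) → (S : Subset n) (C : Fin m → Subset n) →
                    (∀ {u} → u ∈ S → ∃ λ v → u ∈ C v) → sumOver G a S ≤ ΣFin m (λ v → sumOver G a (C v))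
  sumOver-≤-cover {m} {a} a≥0 S C covers = begin
    sumOver G a S                                                  ≤⟨ ΣFin-mono-≤ n bound ⟩
    ΣFin n (λ u → ΣFin m (λ v → if lookup (C v) u then a u else 0ℚ)) ≡⟨ ΣFin-comm n m _ ⟩
    ΣFin m (λ v → sumOver G a (C v))                               ∎
    where
    open ≤-Reasoning
    bound : ∀ u → (if lookup S u then a u else 0ℚ) ≤ ΣFin m (λ v → if lookup (C v) u then a u else 0ℚ)
    bound u with lookup S u in u∈S
    ... | false = ΣFin-nonneg m (λ v → if-nonneg (lookup (C v) u) (a≥0 u))
    ... | true with covers (lookup⇒[]= u S u∈S)
    ...   | v , u∈Cv = subst (_≤ _) (cong (if_then a u else 0ℚ) ([]=⇒lookup u∈Cv))
                         (term≤ΣFin m (λ v → if-nonneg (lookup (C v) u) (a≥0 u)) v)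

  sumOver-∅ : (a : Fin n → ℚ) → sumOver G a ∅ ≡ 0ℚ
  sumOver-∅ a =
    trans (ΣFin-cong n (λ i → cong (if_then a i else 0ℚ) (lookup-replicate i false))) (ΣFin-zero n)

  Joins : EdgeSet G → Fin n → Fin n → Set
  Joins K i j = K i j ≡ true ⊎ K j i ≡ true

  edgeWeight-mono-≤ : (A B : EdgeSet G) →
                      (∀ i j → A i j ≡ true → A j i ≡ true → ⊥) → (∀ i j → A i j ≡ true → Joins B i j) →
                      edgeWeight G A ≤ edgeWeight G B
  edgeWeight-mono-≤ A B A-asym A-joins = ΣFin²-mono-≤-symmetrised n pair
    where
    pair : ∀ i j → (if A i j then w i j else 0ℚ) + (if A j i then w j i else 0ℚ)
                 ≤ (if B i j then w i j else 0ℚ) + (if B j i then w j i else 0ℚ)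
    pair i j rewrite w-sym j i =
      if-pair-≤ (w-nonneg i j) (A i j) (A j i) (B i j) (B j i) (A-asym i j) (A-joins i j) (A-joins j i)

  Joins⇒adj : {K : EdgeSet G} → IsEdgeSet G K → ∀ {i j} → Joins K i j → adj i j ≡ true
  Joins⇒adj K-edges {i} {j} (inj₁ Kij) = proj₂ (K-edges i j Kij)
  Joins⇒adj K-edges {i} {j} (inj₂ Kji) = trans (adj-sym i j) (proj₂ (K-edges j i Kji))

  adj⇒≢ : ∀ {i j} → adj i j ≡ true → i ≢ j
  adj⇒≢ {i} adj-ij refl = contradiction (trans (sym adj-ij) (adj-irrefl i)) λ ()

  module Orientation {R : Rel (Fin n) 0ℓ} (R? : Decidable R) (R⇒adj : ∀ {i j} → R i j → adj i j ≡ true) where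

    Oriented : Rel (Fin n) 0ℓ
    Oriented i j = i < j × (R i j ⊎ R j i)

    oriented? : Decidable Oriented
    oriented? i j = (i <? j) ×-dec (R? i j ⊎-dec R? j i)

    orient : EdgeSet G
    orient i j = does (oriented? i j)

    orient-sound : ∀ {i j} → orient i j ≡ true → Oriented i j
    orient-sound {i} {j} = does≡true⇒ (oriented? i j)

    orient-isEdgeSet : IsEdgeSet G orient
    orient-isEdgeSet i j Kij with orient-sound Kij
    ... | i<j , inj₁ Rij = i<j , R⇒adj Rij
    ... | i<j , inj₂ Rji = i<j , trans (adj-sym i j) (R⇒adj Rji)

    orient-joins : ∀ {i j} → R i j → Joins orient i j
    orient-joins {i} {j} Rij with <-cmp i j
    ... | tri< i<j _ _ = inj₁ (dec-true (oriented? i j) (i<j , inj₁ Rij))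
    ... | tri≈ _ i≡j _ = contradiction i≡j (adj⇒≢ (R⇒adj Rij))
    ... | tri> _ _ j<i = inj₂ (dec-true (oriented? j i) (j<i , inj₂ Rij))

    edgeWeight-orient-≤ : edgeWeight G orient ≤ edgeWeight G (λ i j → does (R? i j))
    edgeWeight-orient-≤ = edgeWeight-mono-≤ orient (λ i j → does (R? i j)) orient-asym R-joins
      where
      orient-asym : ∀ i j → orient i j ≡ true → orient j i ≡ true → ⊥
      orient-asym _ _ Kij Kji = <-asym (proj₁ (orient-sound Kij)) (proj₁ (orient-sound Kji))
      R-joins : ∀ i j → orient i j ≡ true → Joins (λ i j → does (R? i j)) i j
      R-joins i j Kij = Sum.map (dec-true (R? i j)) (dec-true (R? j i)) (proj₂ (orient-sound Kij))

  module Spokes (v : Fin n) (T : Subset n) (T⊆N : T ⊆ nbhd G v) where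

    Spoke : Rel (Fin n) 0ℓ
    Spoke i j = i ≡ v × j ∈ T

    spoke? : Decidable Spoke
    spoke? i j = (i ≟ v) ×-dec (j ∈? T)

    spoke⇒adj : ∀ {i j} → Spoke i j → adj i j ≡ true
    spoke⇒adj (refl , j∈T) = ∈-tabulate⁻ (T⊆N j∈T)

    open Orientation spoke? spoke⇒adj public

    spokes-feasible : Nonempty T → FeasibleCover G (T ∪ ⁅ v ⁆) orient
    spokes-feasible (t , t∈T) = orient-isEdgeSet , endpoint , covered
      where
      v∈S : v ∈ T ∪ ⁅ v ⁆
      v∈S = x∈p∪q⁺ (inj₂ (x∈⁅x⁆ v))
      endpoint : ∀ i j → orient i j ≡ true → i ∈ T ∪ ⁅ v ⁆ ⊎ j ∈ T ∪ ⁅ v ⁆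
      endpoint i j Kij with proj₂ (orient-sound {i} {j} Kij)
      ... | inj₁ (refl , _) = inj₁ v∈S
      ... | inj₂ (refl , _) = inj₂ v∈S
      covered : ∀ s → s ∈ T ∪ ⁅ v ⁆ → ∃ λ u → Joins orient s u
      covered s s∈S with x∈p∪q⁻ T ⁅ v ⁆ s∈S
      ... | inj₁ s∈T = v , Sum.swap (orient-joins (refl , s∈T))
      ... | inj₂ s∈v rewrite x∈⁅y⁆⇒x≡y v s∈v = t , orient-joins (refl , t∈T)

    edgeWeight-spokes : edgeWeight G (λ i j → does (spoke? i j)) ≡ starWeight G v T
    edgeWeight-spokes = trans (ΣFin-supported n v off-centre) (ΣFin-cong n at-centre)
      where
      off-centre : ∀ i → i ≢ v → ΣFin n (λ j → if does (spoke? i j) then w i j else 0ℚ) ≡ 0ℚ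
      off-centre i i≢v =
        trans (ΣFin-cong n (λ j → cong (if_then w i j else 0ℚ) (dec-false (spoke? i j) (i≢v ∘ proj₁))))
              (ΣFin-zero n)
      at-centre : ∀ j → (if does (spoke? v j) then w v j else 0ℚ) ≡ (if lookup T j then w v j else 0ℚ)
      at-centre j = cong (if_then w v j else 0ℚ)
                         (trans (cong (_∧ does (j ∈? T)) (dec-true (v ≟ v) refl)) (does-∈? j T))

  module StarPacking (S : Subset n) (K : EdgeSet G) (K-edges : IsEdgeSet G K)
                     (p : Fin n → Fin n) (p-joins : ∀ {u} → u ∈ S → Joins K u (p u)) where

    Leaf : Rel (Fin n) 0ℓ
    Leaf v u = u ∈ S × p u ≡ v

    leaf? : Decidable Leaf
    leaf? v u = (u ∈? S) ×-dec (p u ≟ v)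

    -- If u and v are each other's partners, the edge {u,v} must be counted once:
    -- only the larger endpoint remains a leaf.
    Arc : Rel (Fin n) 0ℓ
    Arc v u = Leaf v u × ¬ (Leaf u v × u < v)

    arc? : Decidable Arc
    arc? v u = leaf? v u ×-dec ¬? (leaf? u v ×-dec (u <? v))

    arcs : EdgeSet G
    arcs v u = does (arc? v u)

    leaves : Fin n → Subset n
    leaves v = tabulate (arcs v)

    arc⇒joins : ∀ {v u} → Arc v u → Joins K u v
    arc⇒joins ((u∈S , refl) , _) = p-joins u∈S

    arc-asym : ∀ {v u} → Arc v u → Arc u v → ⊥
    arc-asym {v} {u} (leaf-vu , ¬u<v) (leaf-uv , ¬v<u) with <-cmp u v
    ... | tri< u<v _ _ = ¬u<v (leaf-uv , u<v)
    ... | tri> _ _ v<u = ¬v<u (leaf-vu , v<u)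
    ... | tri≈ _ refl _ = adj⇒≢ (Joins⇒adj K-edges (arc⇒joins (leaf-vu , ¬u<v))) refl

    leaves⊆nbhd : ∀ v → leaves v ⊆ nbhd G v
    leaves⊆nbhd v {u} u∈ =
      ∈-tabulate⁺ (trans (adj-sym v u) (Joins⇒adj K-edges (arc⇒joins (does≡true⇒ (arc? v u) (∈-tabulate⁻ u∈)))))

    leaf-or-centre : ∀ {u} → u ∈ S → ∃ λ v → u ∈ leaves v ∪ ⁅ v ⁆ × Nonempty (leaves v)
    leaf-or-centre {u} u∈S with leaf? u (p u) ×-dec (u <? p u)
    ... | no ¬mutual = p u , x∈p∪q⁺ (inj₁ u∈leaves) , u , u∈leaves
      where u∈leaves = ∈-tabulate⁺ (dec-true (arc? (p u) u) ((u∈S , refl) , ¬mutual))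
    ... | yes (leaf-u-pu , u<pu) = u , x∈p∪q⁺ (inj₂ (x∈⁅x⁆ u)) , p u , pu∈leaves
      where pu∈leaves = ∈-tabulate⁺ (dec-true (arc? u (p u)) (leaf-u-pu , λ (_ , pu<u) → <-asym u<pu pu<u))

    -- A centre without leaves is dropped: the star condition says nothing about it.
    starIf : ∀ v → Dec (Nonempty (leaves v)) → Subset n
    starIf v (yes _) = leaves v ∪ ⁅ v ⁆
    starIf v (no  _) = ∅

    star : Fin n → Subset n
    star v = starIf v (nonempty? (leaves v))

    star-covers : ∀ {u} → u ∈ S → ∃ λ v → u ∈ star v
    star-covers {u} u∈S with leaf-or-centre u∈S
    ... | v , u∈ , ne = v , ∈-starIf (nonempty? (leaves v))
      where
      ∈-starIf : ∀ d → u ∈ starIf v d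
      ∈-starIf (yes _)  = u∈
      ∈-starIf (no ¬ne) = contradiction ne ¬ne

    sumOver-star-≤ : ∀ {a} → StarCondition G a → ∀ v → sumOver G a (star v) ≤ starWeight G v (leaves v)
    sumOver-star-≤ {a} star-cond v = bound (nonempty? (leaves v))
      where
      bound : ∀ d → sumOver G a (starIf v d) ≤ starWeight G v (leaves v)
      bound (yes ne) = star-cond v (leaves v) (leaves⊆nbhd v) ne
      bound (no _)   = subst (_≤ _) (sym (sumOver-∅ a))
                         (ΣFin-nonneg n (λ u → if-nonneg (lookup (leaves v) u) (w-nonneg v u)))

    ΣFin-starWeight-leaves-≤ : ΣFin n (λ v → starWeight G v (leaves v)) ≤ edgeWeight G K
    ΣFin-starWeight-leaves-≤ = begin
      ΣFin n (λ v → starWeight G v (leaves v))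
        ≡⟨ ΣFin-cong n (λ v → ΣFin-cong n (λ u → cong (if_then w v u else 0ℚ) (lookup∘tabulate (arcs v) u))) ⟩
      edgeWeight G arcs
        ≤⟨ edgeWeight-mono-≤ arcs K arcs-asym arcs-join ⟩
      edgeWeight G K ∎
      where
      open ≤-Reasoning
      arcs-asym : ∀ v u → arcs v u ≡ true → arcs u v ≡ true → ⊥
      arcs-asym v u a-vu a-uv = arc-asym (does≡true⇒ (arc? v u) a-vu) (does≡true⇒ (arc? u v) a-uv)
      arcs-join : ∀ v u → arcs v u ≡ true → Joins K v u
      arcs-join v u a-vu = Sum.swap (arc⇒joins (does≡true⇒ (arc? v u) a-vu))

    sumOver-≤-edgeWeight : ∀ {a} → (∀ i → 0ℚ ≤ a i) → StarCondition G a → sumOver G a S ≤ edgeWeight G K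
    sumOver-≤-edgeWeight {a} a≥0 star-cond = begin
      sumOver G a S                             ≤⟨ sumOver-≤-cover a≥0 S star star-covers ⟩
      ΣFin n (λ v → sumOver G a (star v))       ≤⟨ ΣFin-mono-≤ n (sumOver-star-≤ star-cond) ⟩
      ΣFin n (λ v → starWeight G v (leaves v))  ≤⟨ ΣFin-starWeight-leaves-≤ ⟩
      edgeWeight G K                            ∎
      where open ≤-Reasoning

lemma5 : ∀ {n : ℕ} (G : WGraph n) (a : Fin n → ℚ) → (∀ i → 0ℚ ≤ a i) →
           CoreProperty G a ⇔ StarCondition G a
lemma5 G a a≥0 = mk⇔ core⇒star star⇒core
  where
  core⇒star : CoreProperty G a → StarCondition G a
  core⇒star core v T T⊆N T≠∅ = begin
    sumOver G a (T ∪ ⁅ v ⁆)                      ≤⟨ core (T ∪ ⁅ v ⁆) orient (spokes-feasible T≠∅) ⟩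
    edgeWeight G orient                          ≤⟨ edgeWeight-orient-≤ ⟩
    edgeWeight G (λ i j → does (spoke? i j))     ≡⟨ edgeWeight-spokes ⟩
    starWeight G v T                             ∎
    where
    open ≤-Reasoning
    open Spokes G v T T⊆N

  star⇒core : StarCondition G a → CoreProperty G a
  star⇒core star-cond S K (K-edges , _ , K-covers) with choose-on S K-covers
  ... | p , p-joins = StarPacking.sumOver-≤-edgeWeight G S K K-edges p p-joins a≥0 star-cond
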